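{- Let $D$ be any digraph and let $f$ be a vertex-direction of $D$. Suppose that $(A_1,B_1)$ and $(A_2,B_2)$ are finite order separations of $D$. (i) If $(A_1,B_1)$ and $(A_2,B_2)$ both point towards $f$, then $(A_1\cup A_2,B_1\cap B_2)$ points towards $f$. (ii) If $(A_1,B_1)$ and $(A_2,B_2)$ both point away from $f$, then $(A_1\cap A_2,B_1\cup B_2)$ points away from $f$.
   Context: Digraphs have no loops and no parallel edges. $\mathcal{X}(D)$ is the set of finite subsets of $V(D)$. A vertex-direction of $D$ is a map $f$ on $\mathcal{X}(D)$ sending each $X$ to a strong component of $D-X$ with $f(X)\supseteq f(Y)$ whenever $X\subseteq Y$. A separation of $D$ is a pair $(A,B)$ of vertex sets with $A\cup B=V(D)$ such that $D$ has no edge from $B\setminus A$ to $A\setminus B$; it has finite order if $A\cap B$ is finite. For a finite order separation $(A,B)$, the strong component $f(A\cap B)$ is contained in $B\setminus A$ or in $A\setminus B$; in the first case $(A,B)$ points towards $f$, in the second it points away from $f$. -}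

module Defs where

open import Level using (0ℓ)
open import Data.Product using (Σ; ∃; _×_; _,_)
open import Data.List using (List)
import Data.List.Membership.Propositional as LM
import Data.List.Relation.Binary.Subset.Propositional as LS
open import Relation.Nullary using (¬_)
open import Relation.Unary using (Pred; _∈_; _∉_; _⊆_; _∩_; _∪_)
open import Relation.Binary.PropositionalEquality using (_≡_)
open import Relation.Binary.Construct.Closure.ReflexiveTransitive using (Star)
open import Function.Bundles using (_⇔_)

-- A digraph: a (possibly infinite) vertex type and an edge relation.
-- No loops; no parallel edges (any two proofs of an edge u→v are equal).
record Digraph : Set₁ where
  field
    V        : Set
    Edge     : V → V → Set
    no-loop  : ∀ v → ¬ Edge v v
    no-multi : ∀ {u v} (e e′ : Edge u v) → e ≡ e′
open Digraph public

VSet : Digraph → Set₁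
VSet D = Pred (V D) 0ℓ

-- finite subsets X ∈ 𝒳(D) are given by lists of vertices
Fin𝒳 : Digraph → Set
Fin𝒳 D = List (V D)

⟦_⟧ : ∀ {D} → Fin𝒳 D → VSet D
⟦ X ⟧ v = v LM.∈ X

EdgeMinus : (D : Digraph) → VSet D → V D → V D → Set
EdgeMinus D X u v = Edge D u v × u ∉ X × v ∉ X

Reach : (D : Digraph) → VSet D → V D → V D → Set
Reach D X = Star (EdgeMinus D X)

IsStrongComponent : (D : Digraph) → VSet D → VSet D → Set
IsStrongComponent D X C =
  Σ (V D) λ v → v ∉ X ×
    (∀ w → (w ∈ C) ⇔ (w ∉ X × Reach D X v w × Reach D X w v))

record VertexDirection (D : Digraph) : Set₁ where
  field
    dir  : Fin𝒳 D → VSet D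
    comp : ∀ X → IsStrongComponent D (⟦_⟧ {D} X) (dir X)
    mono : ∀ (X Y : Fin𝒳 D) → X LS.⊆ Y → dir Y ⊆ dir X
open VertexDirection public

_∖_ : ∀ {D} → VSet D → VSet D → VSet D
(P ∖ Q) v = v ∈ P × v ∉ Q

IsSeparation : (D : Digraph) → VSet D → VSet D → Set
IsSeparation D A B =
  (∀ v → v ∈ (A ∪ B)) ×
  (∀ u v → u ∈ (_∖_ {D} B A) → v ∈ (_∖_ {D} A B) → ¬ Edge D u v)

Enumerates : (D : Digraph) → Fin𝒳 D → VSet D → Set
Enumerates D L S = ∀ v → (v LM.∈ L) ⇔ (v ∈ S)

FiniteOrder : (D : Digraph) → VSet D → VSet D → Set
FiniteOrder D A B = ∃ λ (L : Fin𝒳 D) → Enumerates D L (A ∩ B)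

PointsTowards : (D : Digraph) → VertexDirection D → VSet D → VSet D → Set
PointsTowards D f A B =
  ∀ (L : Fin𝒳 D) → Enumerates D L (A ∩ B) → dir f L ⊆ (_∖_ {D} B A)

PointsAway : (D : Digraph) → VertexDirection D → VSet D → VSet D → Set
PointsAway D f A B =
  ∀ (L : Fin𝒳 D) → Enumerates D L (A ∩ B) → dir f L ⊆ (_∖_ {D} A B)

FinSep : (D : Digraph) → VSet D → VSet D → Set
FinSep D A B = IsSeparation D A B × FiniteOrder D A B

{-# OPTIONS --safe #-}
module Submission where

-- Walks of D − (A ∩ B) cannot leave B ∖ A, since that would use an
-- edge from B ∖ A to A ∖ B; hence every strong component of D − X, for X ⊇ A ∩ B,
-- meeting B ∖ A lies inside it. A vertex v of f(L₁ ∪ L₂ ∪ L), where Lᵢ = Aᵢ ∩ Bᵢ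
-- and L = (A₁ ∪ A₂) ∩ (B₁ ∩ B₂), lies in f(L₁), f(L₂) and f(L), so in
-- (B₁ ∩ B₂) ∖ (A₁ ∪ A₂); thus the component f(L) lies there as well. Part (ii) is
-- part (i) for the reverse digraph, which has the same strong components and in
-- which (B , A) is a separation pointing towards f iff (A , B) points away from f.

open import Defs
open import Level using (0ℓ)
open import Data.Product using (_×_; _,_; proj₁; proj₂; ∃; swap)
open import Data.Sum using (_⊎_; inj₁; inj₂; [_,_])
open import Data.Empty using (⊥-elim)
open import Data.List using (_++_; filter)
open import Function using (_∘_; id; flip)
open import Function.Bundles using (mk⇔; Equivalence)
open import Relation.Nullary using (¬_; yes; no)
open import Relation.Unary using (_∈_; _∉_; _∩_; _∪_; _⊆_)
open import Relation.Binary.Construct.Closure.ReflexiveTransitive using (ε; _◅_; _◅◅_)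
import Relation.Binary.Construct.Closure.ReflexiveTransitive as Star
open import Axiom.ExcludedMiddle using (ExcludedMiddle)
open import Data.List.Membership.Propositional.Properties using (∈-++⁺ˡ; ∈-++⁺ʳ; ∈-filter⁺; ∈-filter⁻)
import Data.List.Relation.Binary.Subset.Propositional as List
open import Data.List.Relation.Binary.Subset.Propositional.Properties using (xs⊆xs++ys; xs⊆ys++xs)

open Equivalence using (to; from)

reverse : Digraph → Digraph
reverse D = record
  { V        = V D
  ; Edge     = flip (Edge D)
  ; no-loop  = no-loop D
  ; no-multi = no-multi D
  }

reach-reverse : ∀ {D X u v} → Reach D X u v → Reach (reverse D) X v u
reach-reverse = Star.reverse λ (e , u∉X , v∉X) → e , v∉X , u∉X

module _ {D : Digraph} where

  isStrongComponent-reverse : ∀ {X C} → IsStrongComponent D X C → IsStrongComponent (reverse D) X C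
  isStrongComponent-reverse (v , v∉X , C⇔) = v , v∉X , λ w → mk⇔
    (λ w∈C → let (w∉X , v↝w , w↝v) = to (C⇔ w) w∈C
             in w∉X , reach-reverse {D} w↝v , reach-reverse {D} v↝w)
    (λ (w∉X , v↝ᵒᵖw , w↝ᵒᵖv) →
       from (C⇔ w) (w∉X , reach-reverse {reverse D} w↝ᵒᵖv , reach-reverse {reverse D} v↝ᵒᵖw))

  strongComponent-nonempty : ∀ {X C} → IsStrongComponent D X C → ∃ C
  strongComponent-nonempty (v , v∉X , C⇔) = v , from (C⇔ v) (v∉X , ε , ε)

  strongComponent-reach : ∀ {X C v w} → IsStrongComponent D X C → C v → C w → Reach D X v w
  strongComponent-reach {v = v} {w} (_ , _ , C⇔) v∈C w∈C =
    proj₂ (proj₂ (to (C⇔ v) v∈C)) ◅◅ proj₁ (proj₂ (to (C⇔ w) w∈C))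

  reverseDirection : VertexDirection D → VertexDirection (reverse D)
  reverseDirection f = record
    { dir  = dir f
    ; comp = isStrongComponent-reverse ∘ comp f
    ; mono = mono f
    }

  enumerates-∩-comm : ∀ {L A B} → Enumerates D L (A ∩ B) → Enumerates D L (B ∩ A)
  enumerates-∩-comm L⇔ v = mk⇔ (swap ∘ to (L⇔ v)) (from (L⇔ v) ∘ swap)

  finSep-reverse : ∀ {A B} → FinSep D A B → FinSep (reverse D) B A
  finSep-reverse ((cover , no-back-edge) , L , L⇔) =
    ((λ v → [ inj₂ , inj₁ ] (cover v)) , λ u v u∈A∖B v∈B∖A → no-back-edge v u v∈B∖A u∈A∖B)
    , L , enumerates-∩-comm L⇔

  pointsAway-reverse : ∀ f {A B} → PointsAway D f A B → PointsTowards (reverse D) (reverseDirection f) B A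
  pointsAway-reverse f away L L⇔ = away L (enumerates-∩-comm L⇔)

  pointsTowards-reverse : ∀ f {A B} → PointsTowards (reverse D) (reverseDirection f) B A → PointsAway D f A B
  pointsTowards-reverse f towards L L⇔ = towards L (enumerates-∩-comm L⇔)

module _ (em : ExcludedMiddle 0ℓ) {D : Digraph} where

  ¬×⇒¬⊎¬ : ∀ {P Q : Set} → ¬ (P × Q) → ¬ P ⊎ ¬ Q
  ¬×⇒¬⊎¬ {P} ¬P×Q with em {P}
  ... | yes p = inj₂ λ q → ¬P×Q (p , q)
  ... | no ¬p = inj₁ ¬p

  enumerable-⊆-∪ : ∀ {L₁ L₂ X₁ X₂ S} → Enumerates D L₁ X₁ → Enumerates D L₂ X₂ →
    S ⊆ X₁ ∪ X₂ → ∃ λ L → Enumerates D L S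
  enumerable-⊆-∪ {L₁} {L₂} {X₁} {X₂} L₁⇔ L₂⇔ S⊆X₁∪X₂ =
    filter (λ _ → em) (L₁ ++ L₂) , λ v → mk⇔
      (proj₂ ∘ ∈-filter⁻ (λ _ → em) {xs = L₁ ++ L₂})
      (λ v∈S → ∈-filter⁺ (λ _ → em) (listed (S⊆X₁∪X₂ v∈S)) v∈S)
    where
    listed : ∀ {v} → v ∈ X₁ ∪ X₂ → v ∈ ⟦_⟧ {D} (L₁ ++ L₂)
    listed (inj₁ v∈X₁) = ∈-++⁺ˡ (from (L₁⇔ _) v∈X₁)
    listed (inj₂ v∈X₂) = ∈-++⁺ʳ L₁ (from (L₂⇔ _) v∈X₂)

  module _ {A B : VSet D} (sep : IsSeparation D A B) where

    ∉ʳ⇒∈ˡ : ∀ {v} → v ∉ B → v ∈ A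
    ∉ʳ⇒∈ˡ {v} v∉B = [ id , ⊥-elim ∘ v∉B ] (proj₁ sep v)

    ∉ˡ⇒∈ʳ : ∀ {v} → v ∉ A → v ∈ B
    ∉ˡ⇒∈ʳ {v} v∉A = [ ⊥-elim ∘ v∉A , id ] (proj₁ sep v)

    reach-preserves-∖ : ∀ {X v w} → A ∩ B ⊆ X → Reach D X v w → v ∈ _∖_ {D} B A → w ∈ _∖_ {D} B A
    reach-preserves-∖ A∩B⊆X ε v∈B∖A = v∈B∖A
    reach-preserves-∖ A∩B⊆X (_◅_ {i = v} {j = u} (e , _ , u∉X) u↝w) v∈B∖A =
      reach-preserves-∖ A∩B⊆X u↝w (∉ˡ⇒∈ʳ u∉A , u∉A)
      where
      u∉A : u ∉ A
      u∉A u∈A with em {u ∈ B}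
      ... | yes u∈B = u∉X (A∩B⊆X (u∈A , u∈B))
      ... | no u∉B = proj₂ sep v u v∈B∖A (u∈A , u∉B) e

    strongComponent-⊆-∖ : ∀ {X C v} → A ∩ B ⊆ X → IsStrongComponent D X C →
      v ∈ C → v ∈ _∖_ {D} B A → C ⊆ _∖_ {D} B A
    strongComponent-⊆-∖ A∩B⊆X C-comp v∈C v∈B∖A w∈C =
      reach-preserves-∖ A∩B⊆X (strongComponent-reach {D} C-comp v∈C w∈C) v∈B∖A

  module _ {A₁ B₁ A₂ B₂ : VSet D} where

    isSeparation-∪∩ : IsSeparation D A₁ B₁ → IsSeparation D A₂ B₂ →
      IsSeparation D (A₁ ∪ A₂) (B₁ ∩ B₂)
    isSeparation-∪∩ sep₁ sep₂ = cover , no-back-edge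
      where
      cover : ∀ v → v ∈ (A₁ ∪ A₂) ∪ (B₁ ∩ B₂)
      cover v with em {v ∈ A₁ ∪ A₂}
      ... | yes v∈A = inj₁ v∈A
      ... | no v∉A = inj₂ (∉ˡ⇒∈ʳ sep₁ (v∉A ∘ inj₁) , ∉ˡ⇒∈ʳ sep₂ (v∉A ∘ inj₂))
      no-back-edge : ∀ u v → u ∈ _∖_ {D} (B₁ ∩ B₂) (A₁ ∪ A₂) → v ∈ _∖_ {D} (A₁ ∪ A₂) (B₁ ∩ B₂) →
        ¬ Edge D u v
      no-back-edge u v ((u∈B₁ , u∈B₂) , u∉A) (_ , v∉B) with ¬×⇒¬⊎¬ v∉B
      ... | inj₁ v∉B₁ = proj₂ sep₁ u v (u∈B₁ , u∉A ∘ inj₁) (∉ʳ⇒∈ˡ sep₁ v∉B₁ , v∉B₁)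
      ... | inj₂ v∉B₂ = proj₂ sep₂ u v (u∈B₂ , u∉A ∘ inj₂) (∉ʳ⇒∈ˡ sep₂ v∉B₂ , v∉B₂)

    finiteOrder-∪∩ : FiniteOrder D A₁ B₁ → FiniteOrder D A₂ B₂ →
      FiniteOrder D (A₁ ∪ A₂) (B₁ ∩ B₂)
    finiteOrder-∪∩ (_ , L₁⇔) (_ , L₂⇔) = enumerable-⊆-∪ L₁⇔ L₂⇔ λ where
      (inj₁ v∈A₁ , v∈B₁ , _) → inj₁ (v∈A₁ , v∈B₁)
      (inj₂ v∈A₂ , _ , v∈B₂) → inj₂ (v∈A₂ , v∈B₂)

    finSep-∪∩ : FinSep D A₁ B₁ → FinSep D A₂ B₂ → FinSep D (A₁ ∪ A₂) (B₁ ∩ B₂)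
    finSep-∪∩ (sep₁ , fin₁) (sep₂ , fin₂) = isSeparation-∪∩ sep₁ sep₂ , finiteOrder-∪∩ fin₁ fin₂

    ∖-∩∪ : ∀ {v} → v ∈ _∖_ {D} B₁ A₁ → v ∈ _∖_ {D} B₂ A₂ → v ∈ _∖_ {D} (B₁ ∩ B₂) (A₁ ∪ A₂)
    ∖-∩∪ (v∈B₁ , v∉A₁) (v∈B₂ , v∉A₂) = (v∈B₁ , v∈B₂) , [ v∉A₁ , v∉A₂ ]

    pointsTowards-∪∩ : (f : VertexDirection D) → FinSep D A₁ B₁ → FinSep D A₂ B₂ →
      PointsTowards D f A₁ B₁ → PointsTowards D f A₂ B₂ →
      PointsTowards D f (A₁ ∪ A₂) (B₁ ∩ B₂)
    pointsTowards-∪∩ f (sep₁ , L₁ , L₁⇔) (sep₂ , L₂ , L₂⇔) towards₁ towards₂ L L⇔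
      with strongComponent-nonempty {D} (comp f (L₁ ++ L₂ ++ L))
    ... | v , v∈fY =
      strongComponent-⊆-∖ (isSeparation-∪∩ sep₁ sep₂) (from (L⇔ _)) (comp f L)
        (v∈f (xs⊆ys++xs _ L₁ ∘ xs⊆ys++xs L L₂))
        (∖-∩∪ (towards₁ L₁ L₁⇔ (v∈f (xs⊆xs++ys L₁ _)))
              (towards₂ L₂ L₂⇔ (v∈f (xs⊆ys++xs _ L₁ ∘ xs⊆xs++ys L₂ L))))
      where
      v∈f : ∀ {M} → M List.⊆ L₁ ++ L₂ ++ L → v ∈ dir f M
      v∈f M⊆Y = mono f _ _ M⊆Y v∈fY

lemma4p3 : ExcludedMiddle 0ℓ →
    (D : Digraph) (f : VertexDirection D) (A₁ B₁ A₂ B₂ : VSet D) →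
    FinSep D A₁ B₁ → FinSep D A₂ B₂ →
    ((PointsTowards D f A₁ B₁ → PointsTowards D f A₂ B₂ →
        FinSep D (A₁ ∪ A₂) (B₁ ∩ B₂) × PointsTowards D f (A₁ ∪ A₂) (B₁ ∩ B₂))
    × (PointsAway D f A₁ B₁ → PointsAway D f A₂ B₂ →
        FinSep D (A₁ ∩ A₂) (B₁ ∪ B₂) × PointsAway D f (A₁ ∩ A₂) (B₁ ∪ B₂)))
lemma4p3 em D f A₁ B₁ A₂ B₂ finSep₁ finSep₂ =
    (λ towards₁ towards₂ →
        finSep-∪∩ em {D} finSep₁ finSep₂
      , pointsTowards-∪∩ em f finSep₁ finSep₂ towards₁ towards₂)
  , (λ away₁ away₂ →
        -- reverse (reverse D) is D up to η, so reversing once more lands back in D.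
        finSep-reverse {reverse D} (finSep-∪∩ em {reverse D} finSep₁ᵒᵖ finSep₂ᵒᵖ)
      , pointsTowards-reverse f (pointsTowards-∪∩ em (reverseDirection f) finSep₁ᵒᵖ finSep₂ᵒᵖ
          (pointsAway-reverse f away₁) (pointsAway-reverse f away₂)))
  where
  finSep₁ᵒᵖ : FinSep (reverse D) B₁ A₁
  finSep₁ᵒᵖ = finSep-reverse {D} finSep₁
  finSep₂ᵒᵖ : FinSep (reverse D) B₂ A₂
  finSep₂ᵒᵖ = finSep-reverse {D} finSep₂
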